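{- Let $base =_{loop} base : S^1$ be the generating loop of the circle. Every computational path generated from $loop$ (i.e. obtained from $\rho$ and $loop$ by finitely many applications of composition $\tau$ and symmetry $\sigma$) is $rw$-equal to a path $loop^n$ for some $n\in\mathbb{Z}$.
   Context: The circle $S^1$ is the higher inductive type generated by a point $base : S^1$ and a computational path $base =_{loop} base : S^1$. Computational paths are syntactic terms built using reflexivity $\rho$, symmetry $\sigma$ (from $a=_r b$ infer $b=_{\sigma(r)} a$) and transitivity $\tau$ (from $a=_r b$, $b=_s c$ infer $a=_{\tau(r,s)}c$); composition of loops is written $r\circ s := \tau(s,r)$. Powers: $loop^0 := \rho$, $loop^{n} := loop^{n-1}\circ loop$ for $n>0$, $loop^{ -n} := loop^{ -(n-1)}\circ\sigma(loop)$ for $n>0$ (so $loop^{ -1}=\sigma(loop)$). Two paths are $rw$-equal if one can be obtained from the other by finitely many applications (and reverse applications) of the rewrite rules of the system $LND_{EQ}$-$TRS$, which include $\tau(r,\sigma(r))\rhd\rho$, $\tau(\sigma(r),r)\rhd\rho$, $\tau(r,\rho)\rhd r$, $\tau(\rho,r)\rhd r$, $\tau(\tau(t,r),s)\rhd\tau(t,\tau(r,s))$. -}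

module Defs where

open import Data.Nat using (ℕ; zero; suc)
open import Data.Integer using (ℤ; +_; -[1+_])

-- Computational paths on S¹ generated from ρ and loop by τ and σ.
-- All such paths are loops base = base, so no endpoint indexing is needed.
data Path : Set where
  ρ    : Path
  loop : Path
  σ    : Path → Path
  τ    : Path → Path → Path

_∘ₚ_ : Path → Path → Path
r ∘ₚ s = τ s r

-- one-step rewriting with the listed LND_EQ-TRS rules, closed under subterms
data _▷_ : Path → Path → Set where
  tr   : ∀ r → τ r (σ r) ▷ ρ
  tsr  : ∀ r → τ (σ r) r ▷ ρ
  trr  : ∀ r → τ r ρ ▷ r
  tlr  : ∀ r → τ ρ r ▷ r
  tt   : ∀ t r s → τ (τ t r) s ▷ τ t (τ r s)
  congσ  : ∀ {r r'} → r ▷ r' → σ r ▷ σ r'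
  congτˡ : ∀ {r r' s} → r ▷ r' → τ r s ▷ τ r' s
  congτʳ : ∀ {r s s'} → s ▷ s' → τ r s ▷ τ r s'

data _=rw_ : Path → Path → Set where
  rw-refl  : ∀ {r} → r =rw r
  rw-step  : ∀ {r s} → r ▷ s → r =rw s
  rw-sym   : ∀ {r s} → r =rw s → s =rw r
  rw-trans : ∀ {r s t} → r =rw s → s =rw t → r =rw t

loopPos : ℕ → Path
loopPos zero    = ρ
loopPos (suc n) = loopPos n ∘ₚ loop

loopNeg : ℕ → Path
loopNeg zero    = ρ
loopNeg (suc n) = loopNeg n ∘ₚ σ loop

loop^ : ℤ → Path
loop^ (+ n)     = loopPos n
loop^ -[1+ n ]  = loopNeg (suc n)

-- The generated paths are interpreted in ℤ (ρ ↦ 0, loop ↦ 1, σ ↦ negation, τ ↦ addition).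
-- Composition of powers is addition of exponents, because a loop next to its inverse
-- cancels once τ is reassociated; and a path q with τ p q =rw ρ is rw-equal to σ p,
-- which settles symmetry.
module Submission where

open import Defs
open import Data.Integer using (ℤ; +_; -[1+_]; _+_; -_; 0ℤ; 1ℤ; -1ℤ)
open import Data.Integer.Properties using (+-assoc; +-identityˡ; +-inverseʳ)
open import Data.Nat using (zero; suc)
open import Data.Product using (∃-syntax; _,_)
open import Level using (0ℓ)
open import Relation.Binary.Bundles using (Setoid)
open import Relation.Binary.PropositionalEquality using (_≡_; refl; sym)

rw-setoid : Setoid 0ℓ 0ℓ
rw-setoid = record
  { Carrier       = Path
  ; _≈_           = _=rw_
  ; isEquivalence = record { refl = rw-refl ; sym = rw-sym ; trans = rw-trans }
  }

open import Relation.Binary.Reasoning.Setoid rw-setoid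

σ-cong : ∀ {r r'} → r =rw r' → σ r =rw σ r'
σ-cong rw-refl        = rw-refl
σ-cong (rw-step r▷r') = rw-step (congσ r▷r')
σ-cong (rw-sym e)     = rw-sym (σ-cong e)
σ-cong (rw-trans e f) = rw-trans (σ-cong e) (σ-cong f)

τ-congˡ : ∀ {r r' s} → r =rw r' → τ r s =rw τ r' s
τ-congˡ rw-refl        = rw-refl
τ-congˡ (rw-step r▷r') = rw-step (congτˡ r▷r')
τ-congˡ (rw-sym e)     = rw-sym (τ-congˡ e)
τ-congˡ (rw-trans e f) = rw-trans (τ-congˡ e) (τ-congˡ f)

τ-congʳ : ∀ {r s s'} → s =rw s' → τ r s =rw τ r s'
τ-congʳ rw-refl        = rw-refl
τ-congʳ (rw-step s▷s') = rw-step (congτʳ s▷s')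
τ-congʳ (rw-sym e)     = rw-sym (τ-congʳ e)
τ-congʳ (rw-trans e f) = rw-trans (τ-congʳ e) (τ-congʳ f)

τ-cong : ∀ {r r' s s'} → r =rw r' → s =rw s' → τ r s =rw τ r' s'
τ-cong e f = rw-trans (τ-congˡ e) (τ-congʳ f)

τ-cancelˡ : ∀ r s → τ r (τ (σ r) s) =rw s
τ-cancelˡ r s = begin
  τ r (τ (σ r) s)  ≈⟨ rw-sym (rw-step (tt r (σ r) s)) ⟩
  τ (τ r (σ r)) s  ≈⟨ rw-step (congτˡ (tr r)) ⟩
  τ ρ s            ≈⟨ rw-step (tlr s) ⟩
  s                ∎

σ-cancelˡ : ∀ r s → τ (σ r) (τ r s) =rw s
σ-cancelˡ r s = begin
  τ (σ r) (τ r s)  ≈⟨ rw-sym (rw-step (tt (σ r) r s)) ⟩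
  τ (τ (σ r) r) s  ≈⟨ rw-step (congτˡ (tsr r)) ⟩
  τ ρ s            ≈⟨ rw-step (tlr s) ⟩
  s                ∎

inverse-unique : ∀ {r s} → τ r s =rw ρ → σ r =rw s
inverse-unique {r} {s} rs≈ρ = begin
  σ r              ≈⟨ rw-sym (rw-step (trr (σ r))) ⟩
  τ (σ r) ρ        ≈⟨ τ-congʳ (rw-sym rs≈ρ) ⟩
  τ (σ r) (τ r s)  ≈⟨ σ-cancelˡ r s ⟩
  s                ∎

≡⇒loop^-=rw : ∀ {m n} → m ≡ n → loop^ m =rw loop^ n
≡⇒loop^-=rw refl = rw-refl

τ-loop-loop^ : ∀ n → τ loop (loop^ n) =rw loop^ (1ℤ + n)
τ-loop-loop^ (+ _)          = rw-refl
τ-loop-loop^ -[1+ zero ]    = τ-cancelˡ loop ρ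
τ-loop-loop^ -[1+ suc k ]   = τ-cancelˡ loop (loopNeg (suc k))

τ-σloop-loop^ : ∀ n → τ (σ loop) (loop^ n) =rw loop^ (-1ℤ + n)
τ-σloop-loop^ -[1+ _ ]      = rw-refl
τ-σloop-loop^ (+ zero)      = rw-refl
τ-σloop-loop^ (+ suc k)     = σ-cancelˡ loop (loopPos k)

τ-loop^-loop^ : ∀ m n → τ (loop^ m) (loop^ n) =rw loop^ (m + n)
τ-loop^-loop^ (+ zero) n = begin
  τ ρ (loop^ n)   ≈⟨ rw-step (tlr (loop^ n)) ⟩
  loop^ n         ≈⟨ ≡⇒loop^-=rw (sym (+-identityˡ n)) ⟩
  loop^ (0ℤ + n)  ∎
τ-loop^-loop^ (+ suc k) n = begin
  τ (τ loop (loopPos k)) (loop^ n)    ≈⟨ rw-step (tt loop (loopPos k) (loop^ n)) ⟩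
  τ loop (τ (loop^ (+ k)) (loop^ n))  ≈⟨ τ-congʳ (τ-loop^-loop^ (+ k) n) ⟩
  τ loop (loop^ (+ k + n))            ≈⟨ τ-loop-loop^ (+ k + n) ⟩
  loop^ (1ℤ + (+ k + n))              ≈⟨ ≡⇒loop^-=rw (sym (+-assoc 1ℤ (+ k) n)) ⟩
  loop^ (+ suc k + n)                 ∎
τ-loop^-loop^ -[1+ zero ] n = begin
  τ (τ (σ loop) ρ) (loop^ n)  ≈⟨ rw-step (congτˡ (trr (σ loop))) ⟩
  τ (σ loop) (loop^ n)        ≈⟨ τ-σloop-loop^ n ⟩
  loop^ (-1ℤ + n)             ∎
τ-loop^-loop^ -[1+ suc k ] n = begin
  τ (τ (σ loop) (loopNeg (suc k))) (loop^ n)  ≈⟨ rw-step (tt (σ loop) (loopNeg (suc k)) (loop^ n)) ⟩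
  τ (σ loop) (τ (loop^ -[1+ k ]) (loop^ n))   ≈⟨ τ-congʳ (τ-loop^-loop^ -[1+ k ] n) ⟩
  τ (σ loop) (loop^ (-[1+ k ] + n))           ≈⟨ τ-σloop-loop^ (-[1+ k ] + n) ⟩
  loop^ (-1ℤ + (-[1+ k ] + n))                ≈⟨ ≡⇒loop^-=rw (sym (+-assoc -1ℤ -[1+ k ] n)) ⟩
  loop^ (-[1+ suc k ] + n)                    ∎

σ-loop^ : ∀ n → σ (loop^ n) =rw loop^ (- n)
σ-loop^ n = inverse-unique (begin
  τ (loop^ n) (loop^ (- n))  ≈⟨ τ-loop^-loop^ n (- n) ⟩
  loop^ (n + - n)            ≈⟨ ≡⇒loop^-=rw (+-inverseʳ n) ⟩
  ρ                          ∎)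

lemma1 : (p : Path) → ∃[ n ] (p =rw loop^ n)
lemma1 ρ    = 0ℤ , rw-refl
lemma1 loop = 1ℤ , rw-sym (rw-step (trr loop))
lemma1 (σ p) with lemma1 p
... | n , p≈ = - n , rw-trans (σ-cong p≈) (σ-loop^ n)
lemma1 (τ p q) with lemma1 p | lemma1 q
... | m , p≈ | n , q≈ = m + n , rw-trans (τ-cong p≈ q≈) (τ-loop^-loop^ m n)
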